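{- Let $c\in\mathbb N^m$ with $m\ge2$ and let $M$ be a proper $c$-multicomplex. (a) For each $k$ with $1\le k\le m$, if $M=\langle x_1,\ldots,x_k\rangle$, then $\mathrm{Bier}_c(M)$ is a stacked sphere and $P_M\in\mathrm{vc}^k(\Delta^{|c|-1})$. (b) If $\mathrm{Bier}_c(M)$ is a stacked sphere and $P_M\in\mathrm{vc}^k(\Delta^{|c|-1})$, then $0\le k\le m$.
   Context: Here $c=(c_1,\ldots,c_m)$ with all $c_i\ge1$ integers and $|c|=c_1+\cdots+c_m$. A $c$-monomial is $x^a=x_1^{a_1}\cdots x_m^{a_m}$ with $0\le a_i\le c_i$. A $c$-multicomplex is a nonempty set $M$ of $c$-monomials closed under taking divisors; proper means not the set of all $c$-monomials; $\langle m_1,\ldots,m_r\rangle$ is the $c$-multicomplex of all divisors of $m_1,\ldots,m_r$. Let $\tilde X=\{x_i^{(j)}: 1\le i\le m,\ 0\le j\le c_i\}$. For a $c$-monomial $x^a$, $1\le i\le m$, $a_i<j\le c_i$, put $G(x^a;x_i^j)=\tilde X\setminus\{x_1^{(a_1)},\ldots,x_m^{(a_m)},x_i^{(j)}\}$ and let $x^a\diamond x_i^j$ be obtained from $x^a$ by replacing $a_i$ by $j$. The Murai sphere $\mathrm{Bier}_c(M)$ is the simplicial complex on $\tilde X$ whose facets are the sets $G(x^a;x_i^j)$ with $x^a\in M$, $a_i<j\le c_i$, $x^a\diamond x_i^j\notin M$; it is a sphere of dimension $|c|-2$ (ghost vertices, i.e. elements of $\tilde X$ in no face, are ignored). For $k,n\ge0$,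 $\mathrm{vc}^k(\Delta^n)$ is the set of (combinatorial types of) simple polytopes obtained from the $n$-simplex by successively cutting off $k$ vertices by hyperplanes in general position. A stacked sphere is a simplicial complex isomorphic to the boundary of a simplicial polytope obtained from a simplex by successively gluing pyramids over facets; equivalently the nerve complex $\partial P^*$ of a truncation polytope $P$. When $\mathrm{Bier}_c(M)$ is stacked, $P_M$ denotes the simple polytope with $\mathrm{Bier}_c(M)\cong\partial P_M^*$. -}

module Defs where

open import Data.Nat using (ℕ; zero; suc; _+_; _∸_; _≤_; _<_)
open import Data.Fin as Fin using (Fin; toℕ)
open import Data.Fin.Properties using () renaming (_≟_ to _≟F_)
open import Data.Bool using (Bool; true; false; not; _∧_; if_then_else_)
open import Data.Vec using (Vec; _∷_; []; lookup; _[_]≔_)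
open import Data.List using (List; []; _∷_; _++_; map; concatMap; allFin; length; removeAt)
open import Data.Nat.ListAction using (sum)
import Data.List as L
open import Data.List.Membership.Propositional using (_∈_)
open import Data.Product using (Σ; ∃; ∃-syntax; _×_; _,_)
open import Relation.Nullary using (¬_; yes; no)
open import Relation.Nullary.Decidable using (⌊_⌋)
open import Relation.Binary.PropositionalEquality using (_≡_; refl)
open import Function using (_⇔_)
open import Function.Definitions using (Injective)

∣_∣c : {m : ℕ} → (Fin m → ℕ) → ℕ
∣ c ∣c = sum (L.tabulate c)

-- a c-monomial x^a, 0 ≤ aᵢ ≤ cᵢ, given by its exponent vector
Mono : {m : ℕ} → (Fin m → ℕ) → Set
Mono {m} c = (i : Fin m) → Fin (suc (c i))

_∣ᵐ_ : {m : ℕ} {c : Fin m → ℕ} → Mono c → Mono c → Set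
_∣ᵐ_ {m} b a = (i : Fin m) → toℕ (b i) ≤ toℕ (a i)

record IsMulticomplex {m : ℕ} (c : Fin m → ℕ) (M : Mono c → Set) : Set where
  field
    nonempty : ∃[ a ] M a
    divClosed : (a b : Mono c) → M a → b ∣ᵐ a → M b

Proper : {m : ℕ} (c : Fin m → ℕ) (M : Mono c → Set) → Set
Proper c M = ∃[ a ] ¬ M a

-- exponent of the variable x_t at position i (1 if i = t, else 0)
δ : {m : ℕ} → Fin m → Fin m → ℕ
δ t i = if ⌊ i ≟F t ⌋ then 1 else 0

-- M = ⟨x₁,…,x_k⟩ : M consists exactly of the divisors of x_t, t < k
-- (indices are 0-based: Fin m = {0,…,m-1}, so x_{t+1} ↦ t)
IsGenByFirstVars : {m : ℕ} (c : Fin m → ℕ) (k : ℕ) (M : Mono c → Set) → Set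
IsGenByFirstVars {m} c k M =
  (a : Mono c) → M a ⇔ (∃[ t ] (toℕ t < k × ((i : Fin m) → toℕ (a i) ≤ δ t i)))

-- the ground set X̃ = { x_i^(j) : i ∈ [m], 0 ≤ j ≤ c_i }
Vtx : {m : ℕ} → (Fin m → ℕ) → Set
Vtx {m} c = Σ (Fin m) (λ i → Fin (suc (c i)))

_⋄_↦_ : {m : ℕ} {c : Fin m → ℕ} → Mono c → (i : Fin m) → Fin (suc (c i)) → Mono c
(a ⋄ i ↦ j) i' with i' ≟F i
... | yes refl = j
... | no _ = a i'

isVtx : {m : ℕ} {c : Fin m → ℕ} → (i : Fin m) → Fin (suc (c i)) → Vtx c → Bool
isVtx i j (i' , j') with i' ≟F i
... | yes refl = ⌊ j' ≟F j ⌋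
... | no _ = false

-- characteristic function of G(x^a ; x_i^j) = X̃ ∖ {x_1^(a_1),…,x_m^(a_m), x_i^(j)}
Gset : {m : ℕ} {c : Fin m → ℕ} → Mono c → (i : Fin m) → Fin (suc (c i)) → Vtx c → Bool
Gset {c = c} a i j (i' , j') = not (isVtx {c = c} i' (a i') (i' , j')) ∧ not (isVtx {c = c} i j (i' , j'))

BierFacet : {m : ℕ} (c : Fin m → ℕ) (M : Mono c → Set) → (Vtx c → Bool) → Set
BierFacet c M G =
  ∃[ a ] (M a × ∃[ i ] ∃[ j ] (toℕ (a i) < toℕ j × ¬ M (a ⋄ i ↦ j)
     × ((v : Vtx c) → G v ≡ Gset a i j v)))

-- Stacked spheres obtained from ∂Δⁿ by k stackings
-- (dually: nerve complexes ∂P* of P ∈ vc^k(Δⁿ))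

Subset : ℕ → Set
Subset N = Vec Bool N

full : (N : ℕ) → Subset N
full zero = []
full (suc N) = true ∷ full N

simplexBoundary : (n : ℕ) → List (Subset (suc n))
simplexBoundary n = map (λ v → full (suc n) [ v ]≔ false) (allFin (suc n))

-- stacking a pyramid on facet F (stellar subdivision of F) with the new
-- vertex placed at index 0: F is removed and replaced by the facets
-- (F ∖ {v}) ∪ {new} for v ∈ F; old facets are kept (new vertex absent).
coneFacets : {N : ℕ} → Subset N → List (Subset (suc N))
coneFacets {N} F =
  concatMap (λ v → if lookup F v then (true ∷ (F [ v ]≔ false)) ∷ [] else [])
            (allFin N)

stackAt : {N : ℕ} → (Fs : List (Subset N)) → Fin (length Fs) → List (Subset (suc N))
stackAt Fs j = map (false ∷_) (removeAt Fs j) ++ coneFacets (L.lookup Fs j)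

data Stacked (n : ℕ) : (k : ℕ) → List (Subset (k + suc n)) → Set where
  base : Stacked n 0 (simplexBoundary n)
  step : {k : ℕ} {Fs : List (Subset (k + suc n))} →
         Stacked n k Fs → (j : Fin (length Fs)) → Stacked n (suc k) (stackAt Fs j)

-- Bier_c(M) (ghost vertices ignored) is isomorphic to a complex obtained from
-- ∂Δⁿ by k stackings, i.e. Bier_c(M) is stacked and P_M ∈ vc^k(Δⁿ).
-- The isomorphism is an injective vertex map e whose image is exactly the
-- set of non-ghost vertices, inducing a bijection of facets.
BierStackedVC : {m : ℕ} (c : Fin m → ℕ) (M : Mono c → Set) (n k : ℕ) → Set
BierStackedVC c M n k =
  Σ (List (Subset (k + suc n))) λ Fs → Stacked n k Fs ×
  Σ (Fin (k + suc n) → Vtx c) λ e → Injective _≡_ _≡_ e ×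
    ((G : Vtx c → Bool) → BierFacet c M G →
       (v : Vtx c) → G v ≡ true → ∃[ w ] (e w ≡ v)) ×
    ((G : Vtx c → Bool) → BierFacet c M G →
       ∃[ S ] (S ∈ Fs × ((w : Fin (k + suc n)) → G (e w) ≡ lookup S w))) ×
    ((S : Subset (k + suc n)) → S ∈ Fs →
       ∃[ G ] (BierFacet c M G × ((w : Fin (k + suc n)) → G (e w) ≡ lookup S w)))

{-# OPTIONS --safe #-}

-- For a duplicate-free list ts of variables, the monomials of ⟨x_t : t ∈ ts⟩ are 1 and the
-- x_t, so the facets of its Bier sphere are the sets G(1; u) and G(x_t; u), and its vertices
-- are the x_i^(j) with j ≥ 1 together with the x_t^(0), t ∈ ts. For ts = [] the facets are the
-- complements of single vertices among the |c| vertices x_i^(j), j ≥ 1: the boundary of a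
-- simplex. Adding a variable t₀ deletes the single facet G(1; x_t₀^1) and creates the facets
-- G(x_t₀; u), u ∈ G(1; x_t₀^1), each of which is G(1; x_t₀^1) with u replaced by the new vertex
-- x_t₀^(0): this is a stacking on G(1; x_t₀^1). So ⟨x_1,…,x_k⟩ yields k stackings of ∂Δ^{|c|-1}.
-- Conversely, k stackings of ∂Δ^{|c|-1} have k + |c| vertices, which embed into X̃, of size m + |c|.

module Submission where

open import Defs
open import Data.Bool using (Bool; true; false; T; not; if_then_else_)
open import Data.Bool.Properties using (T-∧; T-≡)
open import Data.Empty using (⊥-elim)
open import Data.Fin using (Fin; zero; suc; toℕ; cast; fromℕ<; inject≤; splitAt; join; _↑ˡ_; _↑ʳ_)
open import Data.Fin.Properties
  using (_≟_; toℕ-injective; toℕ-cast; cast-involutive; toℕ-fromℕ<; toℕ-inject≤; inject≤-injective; toℕ<n;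
         splitAt-↑ˡ; splitAt-↑ʳ; splitAt-join; join-splitAt; injective⇒≤)
open import Data.List using (List; []; _∷_; _++_; map; concatMap; allFin; length)
import Data.List as L
open import Data.List.Properties using (length-tabulate)
open import Data.List.Membership.Propositional using (_∈_; _∉_; find; lose)
open import Data.List.Membership.Propositional.Properties
  using (∈-map⁺; ∈-map⁻; ∈-++⁻; ∈-++⁺ˡ; ∈-++⁺ʳ; ∈-concatMap⁺; ∈-concatMap⁻; ∈-allFin;
         ∈-tabulate⁺; ∈-tabulate⁻)
import Data.List.Relation.Unary.All as All
import Data.List.Relation.Unary.All.Properties as All
open import Data.List.Relation.Unary.Any using (here; there; index; _─_)
open import Data.List.Relation.Unary.Any.Properties using (lookup-index)
open import Data.List.Relation.Unary.AllPairs using ([]; _∷_)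
open import Data.List.Relation.Unary.Unique.Propositional using (Unique)
open import Data.List.Relation.Unary.Unique.Propositional.Properties
  using (++⁺; map⁺; allFin⁺; tabulate⁺; Unique[x∷xs]⇒x∉xs)
open import Data.Nat using (ℕ; suc; _+_; _∸_; _≤_; _<_; z≤n; s≤s)
import Data.Nat as ℕ
open import Data.Nat.Properties
  using (≤-reflexive; ≤-trans; ≤-antisym; <-irrefl; <-≤-trans; ≤-<-trans; <⇒≱; >⇒≢; ≤∧≢⇒<; 0≢1+n;
         n≤0⇒n≡0; n≢0⇒n>0; +-cancelʳ-≤; m≤m+n; m+[n∸m]≡n)
open import Data.Product as Product using (Σ; ∃-syntax; _×_; _,_; proj₁; proj₂)
open import Data.Sum using (_⊎_; inj₁; inj₂; [_,_]′)
open import Data.Sum.Properties using (inj₂-injective)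
open import Data.Unit using (tt)
open import Data.Vec using (Vec; _∷_; lookup; _[_]≔_; tabulate)
open import Data.Vec.Properties using (lookup∘update; lookup∘update′; ∷-injectiveʳ; tabulate∘lookup; tabulate-cong)
open import Function using (_∘_; id; _⇔_; mk⇔; Equivalence)
open import Function.Definitions using (Injective)
open import Function.Properties.Equivalence using () renaming (trans to ⇔-trans; sym to ⇔-sym)
open import Relation.Nullary using (¬_; yes; no)
open import Relation.Binary.PropositionalEquality using (_≡_; _≢_; ≢-sym; refl; sym; trans; cong; subst; module ≡-Reasoning)

open Equivalence using (to; from)

module _ {a} {A : Set a} {x : A} where

  ∈-─⁻ : ∀ {xs y} (x∈ : x ∈ xs) → y ∈ (xs ─ x∈) → y ∈ xs
  ∈-─⁻ (here refl) y∈ = there y∈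
  ∈-─⁻ (there x∈) (here refl) = here refl
  ∈-─⁻ (there x∈) (there y∈) = there (∈-─⁻ x∈ y∈)

  ∈-─⁺ : ∀ {xs y} (x∈ : x ∈ xs) → y ∈ xs → y ≢ x → y ∈ (xs ─ x∈)
  ∈-─⁺ (here refl) (here refl) y≢x = ⊥-elim (y≢x refl)
  ∈-─⁺ (here refl) (there y∈) _ = y∈
  ∈-─⁺ (there x∈) (here refl) _ = here refl
  ∈-─⁺ (there x∈) (there y∈) y≢x = there (∈-─⁺ x∈ y∈ y≢x)

  ∈-─⇒≢ : ∀ {xs y} → Unique xs → (x∈ : x ∈ xs) → y ∈ (xs ─ x∈) → y ≢ x
  ∈-─⇒≢ (x∉ ∷ _) (here refl) y∈ refl = All.lookup x∉ y∈ refl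
  ∈-─⇒≢ (z∉ ∷ _) (there x∈) (here refl) refl = All.lookup z∉ x∈ refl
  ∈-─⇒≢ (_ ∷ u) (there x∈) (there y∈) = ∈-─⇒≢ u x∈ y∈

  Unique-─⁺ : ∀ {xs} → Unique xs → (x∈ : x ∈ xs) → Unique (xs ─ x∈)
  Unique-─⁺ (_ ∷ u) (here refl) = u
  Unique-─⁺ (z∉ ∷ u) (there x∈) = All.─⁺ x∈ z∉ ∷ Unique-─⁺ u x∈

module _ {a b} {A : Set a} {B : Set b} (f : A → List B) where

  Unique-concatMap⁺ : ∀ {xs} → Unique xs → (∀ x → Unique (f x)) →
                      (∀ {x y z} → z ∈ f x → z ∈ f y → x ≡ y) → Unique (concatMap f xs)
  Unique-concatMap⁺ [] _ _ = []
  Unique-concatMap⁺ (x∉ ∷ u) f-unique f-disjoint =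
    ++⁺ (f-unique _) (Unique-concatMap⁺ u f-unique f-disjoint) λ (z∈fx , z∈rest) →
      let (y , y∈ , z∈fy) = find (∈-concatMap⁻ f z∈rest) in
      All.lookup x∉ y∈ (f-disjoint z∈fx z∈fy)

T⇔T⇒≡ : ∀ {x y} → T x ⇔ T y → x ≡ y
T⇔T⇒≡ {false} {false} _ = refl
T⇔T⇒≡ {false} {true} x⇔y = ⊥-elim (from x⇔y tt)
T⇔T⇒≡ {true} {false} x⇔y = ⊥-elim (to x⇔y tt)
T⇔T⇒≡ {true} {true} _ = refl

T-lookup-full : ∀ {N} (w : Fin N) → T (lookup (full N) w)
T-lookup-full zero = tt
T-lookup-full (suc w) = T-lookup-full w

module _ {N : ℕ} where

  T-lookup-[]≔false : ∀ (S : Vec Bool N) v w → T (lookup (S [ v ]≔ false) w) ⇔ (T (lookup S w) × w ≢ v)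
  T-lookup-[]≔false S v w with w ≟ v
  ... | yes refl rewrite lookup∘update v S false = mk⇔ (λ ()) (λ (_ , v≢v) → v≢v refl)
  ... | no w≢v rewrite lookup∘update′ w≢v S false = mk⇔ (_, w≢v) proj₁

  []≔false-injective : ∀ (S : Vec Bool N) {v v′} → T (lookup S v) → S [ v ]≔ false ≡ S [ v′ ]≔ false → v ≡ v′
  []≔false-injective S {v} {v′} Sv eq with v ≟ v′
  ... | yes v≡v′ = v≡v′
  ... | no v≢v′ = ⊥-elim (proj₂ (to (T-lookup-[]≔false S v v)
                    (subst (λ S′ → T (lookup S′ v)) (sym eq) (from (T-lookup-[]≔false S v′ v) (Sv , v≢v′)))) refl)

module _ {N : ℕ} (F : Vec Bool N) where

  private
    cone : Fin N → List (Vec Bool (suc N))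
    cone v = if lookup F v then (true ∷ (F [ v ]≔ false)) ∷ [] else []

    ∈-cone⁻ : ∀ {S} v → S ∈ cone v → T (lookup F v) × S ≡ true ∷ (F [ v ]≔ false)
    ∈-cone⁻ v S∈ with lookup F v
    ∈-cone⁻ v (here refl) | true = tt , refl

  ∈-coneFacets⁻ : ∀ {S} → S ∈ coneFacets F → ∃[ v ] (T (lookup F v) × S ≡ true ∷ (F [ v ]≔ false))
  ∈-coneFacets⁻ S∈ = let (v , _ , S∈cone) = find (∈-concatMap⁻ cone {xs = allFin N} S∈) in v , ∈-cone⁻ v S∈cone

  ∈-coneFacets⁺ : ∀ {v} → T (lookup F v) → (true ∷ (F [ v ]≔ false)) ∈ coneFacets F
  ∈-coneFacets⁺ {v} Fv = ∈-concatMap⁺ cone (lose (∈-allFin v) (∈-cone⁺ Fv))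
    where
      ∈-cone⁺ : T (lookup F v) → (true ∷ (F [ v ]≔ false)) ∈ cone v
      ∈-cone⁺ Fv with lookup F v
      ... | true = here refl

  coneFacets-unique : Unique (coneFacets F)
  coneFacets-unique = Unique-concatMap⁺ cone (allFin⁺ N) cone-unique cone-disjoint
    where
      cone-unique : ∀ v → Unique (cone v)
      cone-unique v with lookup F v
      ... | true = All.[] ∷ []
      ... | false = []

      cone-disjoint : ∀ {v v′ S} → S ∈ cone v → S ∈ cone v′ → v ≡ v′
      cone-disjoint {v} {v′} S∈ S∈′ with ∈-cone⁻ v S∈ | ∈-cone⁻ v′ S∈′
      ... | Fv , refl | _ , eq = []≔false-injective F Fv (∷-injectiveʳ eq)

module _ {N : ℕ} {Fs : List (Vec Bool N)} {F} (F∈ : F ∈ Fs) where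

  private
    stackAt-≡ : stackAt Fs (index F∈) ≡ map (false ∷_) (Fs ─ F∈) ++ coneFacets F
    stackAt-≡ = cong (λ F′ → map (false ∷_) (Fs ─ F∈) ++ coneFacets F′) (sym (lookup-index F∈))

  ∈-stackAt⁻ : ∀ {S′} → Unique Fs → S′ ∈ stackAt Fs (index F∈) →
               (∃[ S ] (S ∈ Fs × S ≢ F × S′ ≡ false ∷ S)) ⊎
               (∃[ v ] (T (lookup F v) × S′ ≡ true ∷ (F [ v ]≔ false)))
  ∈-stackAt⁻ Fs-unique S′∈ with ∈-++⁻ (map (false ∷_) (Fs ─ F∈)) (subst (_ ∈_) stackAt-≡ S′∈)
  ... | inj₁ S′∈kept = let (S , S∈ , S′≡) = ∈-map⁻ (false ∷_) S′∈kept in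
                       inj₁ (S , ∈-─⁻ F∈ S∈ , ∈-─⇒≢ Fs-unique F∈ S∈ , S′≡)
  ... | inj₂ S′∈cone = inj₂ (∈-coneFacets⁻ F S′∈cone)

  ∈-stackAt⁺ˡ : ∀ {S} → S ∈ Fs → S ≢ F → (false ∷ S) ∈ stackAt Fs (index F∈)
  ∈-stackAt⁺ˡ S∈ S≢F = subst (_ ∈_) (sym stackAt-≡) (∈-++⁺ˡ (∈-map⁺ (false ∷_) (∈-─⁺ F∈ S∈ S≢F)))

  ∈-stackAt⁺ʳ : ∀ {v} → T (lookup F v) → (true ∷ (F [ v ]≔ false)) ∈ stackAt Fs (index F∈)
  ∈-stackAt⁺ʳ Fv = subst (_ ∈_) (sym stackAt-≡) (∈-++⁺ʳ _ (∈-coneFacets⁺ F Fv))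

  stackAt-unique : Unique Fs → Unique (stackAt Fs (index F∈))
  stackAt-unique Fs-unique = subst Unique (sym stackAt-≡)
    (++⁺ (map⁺ ∷-injectiveʳ (Unique-─⁺ Fs-unique F∈)) (coneFacets-unique F) kept∩cone≡∅)
    where
      kept∩cone≡∅ : ∀ {S′} → ¬ (S′ ∈ map (false ∷_) (Fs ─ F∈) × S′ ∈ coneFacets F)
      kept∩cone≡∅ (S′∈kept , S′∈cone) with ∈-map⁻ (false ∷_) S′∈kept | ∈-coneFacets⁻ F S′∈cone
      ... | _ , _ , refl | _ , _ , ()

flatten : ∀ {m} (c : Fin m → ℕ) → Σ (Fin m) (Fin ∘ c) → Fin ∣ c ∣c
flatten c (zero , y) = y ↑ˡ _
flatten c (suc i , y) = c zero ↑ʳ flatten (c ∘ suc) (i , y)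

unflatten : ∀ {m} (c : Fin m → ℕ) → Fin ∣ c ∣c → Σ (Fin m) (Fin ∘ c)
unflatten {suc m} c x =
  [ (zero ,_) , Product.map suc id ∘ unflatten (c ∘ suc) ]′ (splitAt (c zero) x)

unflatten-flatten : ∀ {m} (c : Fin m → ℕ) (p : Σ (Fin m) (Fin ∘ c)) → unflatten c (flatten c p) ≡ p
unflatten-flatten c (zero , y) rewrite splitAt-↑ˡ (c zero) y ∣ c ∘ suc ∣c = refl
unflatten-flatten c (suc i , y)
  rewrite splitAt-↑ʳ (c zero) ∣ c ∘ suc ∣c (flatten (c ∘ suc) (i , y))
        | unflatten-flatten (c ∘ suc) (i , y) = refl

flatten-unflatten : ∀ {m} (c : Fin m → ℕ) (x : Fin ∣ c ∣c) → flatten c (unflatten c x) ≡ x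
flatten-unflatten {suc m} c x with splitAt (c zero) x in eq
... | inj₁ y = trans (cong (join (c zero) _) (sym eq)) (join-splitAt (c zero) _ x)
... | inj₂ z = trans (cong (c zero ↑ʳ_) (flatten-unflatten (c ∘ suc) z))
                     (trans (cong (join (c zero) _) (sym eq)) (join-splitAt (c zero) _ x))

unflatten-injective : ∀ {m} (c : Fin m → ℕ) → Injective _≡_ _≡_ (unflatten c)
unflatten-injective c {x} {x′} eq =
  trans (sym (flatten-unflatten c x)) (trans (cong (flatten c) eq) (flatten-unflatten c x′))

flatten-injective : ∀ {m} (c : Fin m → ℕ) → Injective _≡_ _≡_ (flatten c)
flatten-injective c {p} {q} eq =
  trans (sym (unflatten-flatten c p)) (trans (cong (unflatten c) eq) (unflatten-flatten c q))

cast-injective : ∀ {m n} .(eq : m ≡ n) → Injective _≡_ _≡_ (cast eq)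
cast-injective eq {x} {x′} e = toℕ-injective (trans (sym (toℕ-cast eq x)) (trans (cong toℕ e) (toℕ-cast eq x′)))

module _ {m : ℕ} {c : Fin m → ℕ} where

  vertexCode : Vtx c → Fin m ⊎ Fin ∣ c ∣c
  vertexCode (i , zero) = inj₁ i
  vertexCode (i , suc y) = inj₂ (flatten c (i , y))

  vertexCode-injective : Injective _≡_ _≡_ vertexCode
  vertexCode-injective {i , zero} {.i , zero} refl = refl
  vertexCode-injective {i , suc y} {i′ , suc y′} eq with flatten-injective c {i , y} {i′ , y′} (inj₂-injective eq)
  ... | refl = refl

  vertexIndex : Vtx c → Fin (m + ∣ c ∣c)
  vertexIndex = join m ∣ c ∣c ∘ vertexCode

  vertexIndex-injective : Injective _≡_ _≡_ vertexIndex
  vertexIndex-injective {v} {v′} eq = vertexCode-injective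
    (trans (sym (splitAt-join m _ (vertexCode v))) (trans (cong (splitAt m) eq) (splitAt-join m _ (vertexCode v′))))

bierStackedVC⇒≤ : ∀ {m} {c : Fin m → ℕ} {M n k} → suc n ≡ ∣ c ∣c → BierStackedVC c M n k → k ≤ m
bierStackedVC⇒≤ {m} {c} {k = k} n+1≡∣c∣ (_ , _ , e , e-injective , _) =
  +-cancelʳ-≤ _ k m
    (subst (λ N → k + N ≤ m + ∣ c ∣c) n+1≡∣c∣ (injective⇒≤ (e-injective ∘ vertexIndex-injective)))

module _ {m : ℕ} where

  δ-≡ : (t : Fin m) → δ t t ≡ 1
  δ-≡ t with t ≟ t
  ... | yes _ = refl
  ... | no t≢t = ⊥-elim (t≢t refl)

  δ-≢ : {t i : Fin m} → i ≢ t → δ t i ≡ 0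
  δ-≢ {t} {i} i≢t with i ≟ t
  ... | yes i≡t = ⊥-elim (i≢t i≡t)
  ... | no _ = refl

  δ≤1 : (t i : Fin m) → δ t i ≤ 1
  δ≤1 t i with i ≟ t
  ... | yes _ = s≤s z≤n
  ... | no _ = z≤n

  at-or-off : ∀ {P : Fin m → Set} {t} i → P t → (i ≢ t → P i) → P i
  at-or-off {t = t} i Pt off with i ≟ t
  ... | yes refl = Pt
  ... | no i≢t = off i≢t

  δ>0⇒≡ : {t i : Fin m} → 0 < δ t i → i ≡ t
  δ>0⇒≡ {t} {i} δ>0 with i ≟ t
  ... | yes i≡t = i≡t
  δ>0⇒≡ () | no _

module _ {m : ℕ} {c : Fin m → ℕ} where

  ⋄-≡ : (a : Mono c) (i : Fin m) (j : Fin (suc (c i))) → (a ⋄ i ↦ j) i ≡ j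
  ⋄-≡ a i j with i ≟ i
  ... | yes refl = refl
  ... | no i≢i = ⊥-elim (i≢i refl)

  ⋄-≢ : (a : Mono c) {i i′ : Fin m} (j : Fin (suc (c i))) → i′ ≢ i → (a ⋄ i ↦ j) i′ ≡ a i′
  ⋄-≢ a {i} {i′} j i′≢i with i′ ≟ i
  ... | yes i′≡i = ⊥-elim (i′≢i i′≡i)
  ... | no _ = refl

  exponent : Vtx c → ℕ
  exponent v = toℕ (proj₂ v)

  vertex-≡ : {v v′ : Vtx c} → proj₁ v ≡ proj₁ v′ → exponent v ≡ exponent v′ → v ≡ v′
  vertex-≡ {i , j} {.i , j′} refl e = cong (i ,_) (toℕ-injective e)

  InG : (Fin m → ℕ) → Vtx c → Vtx c → Set
  InG α u v = exponent v ≢ α (proj₁ v) × v ≢ u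

  T-not-isVtx : ∀ i j (v : Vtx c) → T (not (isVtx i j v)) ⇔ v ≢ (i , j)
  T-not-isVtx i j (i′ , j′) with i′ ≟ i
  ... | no i′≢i = mk⇔ (λ _ eq → i′≢i (cong proj₁ eq)) (λ _ → tt)
  ... | yes refl with j′ ≟ j
  ...   | yes refl = mk⇔ (λ ()) (λ v≢v → v≢v refl)
  ...   | no j′≢j = mk⇔ (λ { _ refl → j′≢j refl }) (λ _ → tt)

  T-Gset : ∀ {α} a i j (v : Vtx c) → (∀ i′ → toℕ (a i′) ≡ α i′) → T (Gset a i j v) ⇔ InG α (i , j) v
  T-Gset a i j (i′ , j′) a≗α = mk⇔
    (λ inG → let (not-own , not-u) = to T-∧ inG in
      (λ e → to (T-not-isVtx i′ (a i′) _) not-own (vertex-≡ refl (trans e (sym (a≗α i′))))) ,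
      to (T-not-isVtx i j _) not-u)
    (λ (not-own , not-u) → from T-∧
      (from (T-not-isVtx i′ (a i′) _) (λ eq → not-own (trans (cong exponent eq) (a≗α i′))) ,
       from (T-not-isVtx i j _) not-u))

  _∣x_ : Mono c → Fin m → Set
  a ∣x t = ∀ i → toℕ (a i) ≤ δ t i

  GeneratedBy : List (Fin m) → Mono c → Set
  GeneratedBy ts a = ∃[ t ] (t ∈ ts × a ∣x t)

  ∣x-support : ∀ {a t i} → a ∣x t → 0 < toℕ (a i) → i ≡ t
  ∣x-support {i = i} a∣x a>0 = δ>0⇒≡ (<-≤-trans a>0 (a∣x i))

  ∣x-≤1 : ∀ {a t} i → a ∣x t → toℕ (a i) ≤ 1
  ∣x-≤1 {t = t} i a∣x = ≤-trans (a∣x i) (δ≤1 t i)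

  ∣x-≢ : ∀ {a t i} → a ∣x t → i ≢ t → toℕ (a i) ≡ 0
  ∣x-≢ {i = i} a∣x i≢t = n≤0⇒n≡0 (subst (_ ≤_) (δ-≢ i≢t) (a∣x i))

  ∣x⇒1⊎x : ∀ {a t} → a ∣x t → (∀ i → toℕ (a i) ≡ 0) ⊎ (∀ i → toℕ (a i) ≡ δ t i)
  ∣x⇒1⊎x {a} {t} a∣x with toℕ (a t) ℕ.≟ 0
  ... | yes aₜ≡0 = inj₁ λ i → at-or-off i aₜ≡0 (∣x-≢ a∣x)
  ... | no aₜ≢0 = inj₂ λ i → at-or-off i aₜ≡δₜ (λ i≢t → trans (∣x-≢ a∣x i≢t) (sym (δ-≢ i≢t)))
    where
      aₜ≡δₜ : toℕ (a t) ≡ δ t t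
      aₜ≡δₜ = ≤-antisym (a∣x t) (subst (_≤ toℕ (a t)) (sym (δ-≡ t)) (n≢0⇒n>0 aₜ≢0))

-- Bier spheres of ⟨x_t : t ∈ ts⟩

module Construction {m : ℕ} (c : Fin m → ℕ) (c≥1 : ∀ i → 1 ≤ c i) (n : ℕ) (n+1≡∣c∣ : suc n ≡ ∣ c ∣c) where

  x¹ : Fin m → Vtx c
  x¹ t = t , fromℕ< (s≤s (c≥1 t))

  exponent-x¹ : ∀ t → exponent (x¹ t) ≡ 1
  exponent-x¹ t = toℕ-fromℕ< (s≤s (c≥1 t))

  ≡x¹ : ∀ {u t} → proj₁ u ≡ t → exponent u ≡ 1 → u ≡ x¹ t
  ≡x¹ {t = t} u≡t e≡1 = vertex-≡ u≡t (trans e≡1 (sym (exponent-x¹ t)))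

  xMono : Fin m → Mono c
  xMono t i = fromℕ< (s≤s (≤-trans (δ≤1 t i) (c≥1 i)))

  toℕ-xMono : ∀ t i → toℕ (xMono t i) ≡ δ t i
  toℕ-xMono t i = toℕ-fromℕ< (s≤s (≤-trans (δ≤1 t i) (c≥1 i)))

  sucExponent : Σ (Fin m) (Fin ∘ c) → Vtx c
  sucExponent (i , y) = i , suc y

  sucExponent-injective : Injective _≡_ _≡_ sucExponent
  sucExponent-injective refl = refl

  positiveVertex : Fin (suc n) → Vtx c
  positiveVertex = sucExponent ∘ unflatten c ∘ cast n+1≡∣c∣

  positiveVertex-injective : Injective _≡_ _≡_ positiveVertex
  positiveVertex-injective = cast-injective n+1≡∣c∣ ∘ unflatten-injective c ∘ sucExponent-injective

  positiveVertex-surjective : ∀ i y → ∃[ w ] positiveVertex w ≡ (i , suc y)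
  positiveVertex-surjective i y = cast (sym n+1≡∣c∣) (flatten c (i , y)) ,
    cong sucExponent (trans (cong (unflatten c) (cast-involutive n+1≡∣c∣ (sym n+1≡∣c∣) _)) (unflatten-flatten c (i , y)))

  -- Position 0 holds the most recently added vertex, as in stackAt.
  vertex : (ts : List (Fin m)) → Fin (length ts + suc n) → Vtx c
  vertex [] = positiveVertex
  vertex (t ∷ ts) zero = t , zero
  vertex (t ∷ ts) (suc w) = vertex ts w

  vertex-exponent≡0 : ∀ ts w → exponent (vertex ts w) ≡ 0 → proj₁ (vertex ts w) ∈ ts
  vertex-exponent≡0 (t ∷ ts) zero _ = here refl
  vertex-exponent≡0 (t ∷ ts) (suc w) e = there (vertex-exponent≡0 ts w e)

  vertex≢ : ∀ {t ts} w → t ∉ ts → vertex ts w ≢ (t , zero)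
  vertex≢ {ts = ts} w t∉ts eq = t∉ts (subst (_∈ ts) (cong proj₁ eq) (vertex-exponent≡0 ts w (cong exponent eq)))

  vertex-injective : ∀ {ts} → Unique ts → Injective _≡_ _≡_ (vertex ts)
  vertex-injective {[]} _ = positiveVertex-injective
  vertex-injective {t ∷ ts} _ {zero} {zero} _ = refl
  vertex-injective {t ∷ ts} t∷ts-unique {zero} {suc w} eq = ⊥-elim (vertex≢ w (Unique[x∷xs]⇒x∉xs t∷ts-unique) (sym eq))
  vertex-injective {t ∷ ts} t∷ts-unique {suc w} {zero} eq = ⊥-elim (vertex≢ w (Unique[x∷xs]⇒x∉xs t∷ts-unique) eq)
  vertex-injective {t ∷ ts} (_ ∷ ts-unique) {suc w} {suc w′} eq = cong suc (vertex-injective ts-unique eq)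

  vertex-surjective : ∀ ts v → 0 < exponent v ⊎ proj₁ v ∈ ts → ∃[ w ] vertex ts w ≡ v
  vertex-surjective [] (i , suc y) _ = positiveVertex-surjective i y
  vertex-surjective [] (i , zero) (inj₁ ())
  vertex-surjective [] (i , zero) (inj₂ ())
  vertex-surjective (t ∷ ts) (i , suc y) _ =
    let (w , eq) = vertex-surjective ts (i , suc y) (inj₁ (s≤s z≤n)) in suc w , eq
  vertex-surjective (t ∷ ts) (.t , zero) (inj₂ (here refl)) = zero , refl
  vertex-surjective (t ∷ ts) (i , zero) (inj₁ ())
  vertex-surjective (t ∷ ts) (i , zero) (inj₂ (there i∈)) =
    let (w , eq) = vertex-surjective ts (i , zero) (inj₂ i∈) in suc w , eq

  -- G(1; u) and G(x_t; u); the side conditions say that u lies above the monomial and that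
  -- 1 ⋄ u, resp. x_t ⋄ u, is not in ⟨x_t : t ∈ ts⟩.
  data Facet (ts : List (Fin m)) : Set where
    G₁ : (u : Vtx c) → 0 < exponent u → (exponent u ≡ 1 → proj₁ u ∉ ts) → Facet ts
    Gₓ : (t : Fin m) → t ∈ ts → (u : Vtx c) → δ t (proj₁ u) < exponent u → Facet ts

  ⟦_⟧ : ∀ {ts} → Facet ts → Vtx c → Set
  ⟦ G₁ u _ _ ⟧ = InG (λ _ → 0) u
  ⟦ Gₓ t _ u _ ⟧ = InG (δ t) u

  record Represents (ts : List (Fin m)) (S : Vec Bool (length ts + suc n)) (P : Vtx c → Set) : Set where
    field
      lookup⇔ : ∀ w → T (lookup S w) ⇔ P (vertex ts w)

  open Represents

  represents-injective : ∀ {ts S S′ P} → Represents ts S P → Represents ts S′ P → S ≡ S′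
  represents-injective {S = S} {S′} S-rep S′-rep = begin
    S                    ≡⟨ tabulate∘lookup S ⟨
    tabulate (lookup S)  ≡⟨ tabulate-cong (λ w → T⇔T⇒≡ (⇔-trans (lookup⇔ S-rep w) (⇔-sym (lookup⇔ S′-rep w)))) ⟩
    tabulate (lookup S′) ≡⟨ tabulate∘lookup S′ ⟩
    S′                   ∎
    where open ≡-Reasoning

  represents-≢ : ∀ {ts S S′ P Q v} → Represents ts S P → Represents ts S′ Q →
                 ∃[ w ] vertex ts w ≡ v → P v → ¬ Q v → S ≢ S′
  represents-≢ S-rep S′-rep (w , refl) Pv ¬Qv refl = ¬Qv (to (lookup⇔ S′-rep w) (from (lookup⇔ S-rep w) Pv))

  represents-agree : ∀ {ts S P} {G : Vtx c → Bool} → (∀ v → T (G v) ⇔ P v) → Represents ts S P →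
                     ∀ w → G (vertex ts w) ≡ lookup S w
  represents-agree G⇔P S-rep w = T⇔T⇒≡ (⇔-trans (G⇔P _) (⇔-sym (lookup⇔ S-rep w)))

  represents-∷ : ∀ {ts S P t b} → Represents ts S P → T b ⇔ P (t , zero) → Represents (t ∷ ts) (b ∷ S) P
  lookup⇔ (represents-∷ _ b⇔) zero = b⇔
  lookup⇔ (represents-∷ S-rep _) (suc w) = lookup⇔ S-rep w

  record ListsBierFacets (ts : List (Fin m)) (Fs : List (Vec Bool (length ts + suc n))) : Set where
    field
      unique : Unique Fs
      sound : ∀ {S} → S ∈ Fs → Σ (Facet ts) λ d → Represents ts S ⟦ d ⟧
      complete : (d : Facet ts) → ∃[ S ] (S ∈ Fs × Represents ts S ⟦ d ⟧)

  omit : Fin (suc n) → Vec Bool (suc n)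
  omit v = full (suc n) [ v ]≔ false

  omit-represents : ∀ v → Represents [] (omit v) (InG (λ _ → 0) (positiveVertex v))
  lookup⇔ (omit-represents v) w = mk⇔
    (λ Sw → (λ ()) , proj₂ (to (T-lookup-[]≔false (full (suc n)) v w) Sw) ∘ positiveVertex-injective)
    (λ (_ , w≢v) → from (T-lookup-[]≔false (full (suc n)) v w) (T-lookup-full w , w≢v ∘ cong positiveVertex))

  simplexBoundary-lists : ListsBierFacets [] (simplexBoundary n)
  simplexBoundary-lists = record
    { unique = map⁺ (λ {v} → []≔false-injective (full (suc n)) (T-lookup-full v)) (allFin⁺ _)
    ; sound = λ S∈ → let (v , _ , S≡) = ∈-map⁻ omit {xs = allFin (suc n)} S∈ in
        G₁ (positiveVertex v) (s≤s z≤n) (λ _ ()) ,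
        subst (λ S → Represents [] S (InG (λ _ → 0) (positiveVertex v))) (sym S≡) (omit-represents v)
    ; complete = complete
    }
    where
      complete : (d : Facet []) → ∃[ S ] (S ∈ simplexBoundary n × Represents [] S ⟦ d ⟧)
      complete (G₁ u u>0 _) = let (v , v↦u) = vertex-surjective [] u (inj₁ u>0) in
        omit v , ∈-map⁺ omit (∈-allFin v) ,
        subst (λ u → Represents [] (omit v) (InG (λ _ → 0) u)) v↦u (omit-represents v)
      complete (Gₓ _ () _ _)

  module Stacking {t₀ ts} (t₀∉ts : t₀ ∉ ts) (ts-unique : Unique ts) {Fs} (Fs-lists : ListsBierFacets ts Fs) where

    open ListsBierFacets Fs-lists

    pivot : Facet ts
    pivot = G₁ (x¹ t₀) (s≤s z≤n) (λ _ → t₀∉ts)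

    F : Vec Bool (length ts + suc n)
    F = proj₁ (complete pivot)

    F∈ : F ∈ Fs
    F∈ = proj₁ (proj₂ (complete pivot))

    F-represents : Represents ts F (InG (λ _ → 0) (x¹ t₀))
    F-represents = proj₂ (proj₂ (complete pivot))

    x¹-reached : ∀ t → ∃[ w ] vertex ts w ≡ x¹ t
    x¹-reached t = vertex-surjective ts (x¹ t) (inj₁ (s≤s z≤n))

    t₀≢ : ∀ {t} → t ∈ ts → t₀ ≢ t
    t₀≢ t∈ t₀≡t = t₀∉ts (subst (_∈ ts) (sym t₀≡t) t∈)

    new-vertex-excluded : ∀ α {u : Vtx c} → 0 ≡ α t₀ → T false ⇔ InG α u (t₀ , zero)
    new-vertex-excluded _ 0≡α = mk⇔ (λ ()) (λ (0≢α , _) → 0≢α 0≡α)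

    pivot⇔cone : ∀ {u} → InG (λ _ → 0) (x¹ t₀) u ⇔ δ t₀ (proj₁ u) < exponent u
    pivot⇔cone {u} with proj₁ u ≟ t₀
    ... | yes u≡t₀ = mk⇔
      (λ (u≢0 , u≢x¹) → ≤∧≢⇒< (n≢0⇒n>0 u≢0) (λ 1≡e → u≢x¹ (≡x¹ u≡t₀ (sym 1≡e))))
      (λ 1<e → >⇒≢ (≤-<-trans z≤n 1<e) ,
               λ u≡x¹ → <-irrefl (sym (trans (cong exponent u≡x¹) (exponent-x¹ t₀))) 1<e)
    ... | no u≢t₀ = mk⇔
      (λ (u≢0 , _) → n≢0⇒n>0 u≢0)
      (λ u>0 → >⇒≢ u>0 , u≢t₀ ∘ cong proj₁)

    pivot∖u⇔Gₓ : ∀ {x u} → (exponent x ≡ 0 → proj₁ x ∈ ts) →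
                 (InG (λ _ → 0) (x¹ t₀) x × x ≢ u) ⇔ InG (δ t₀) u x
    pivot∖u⇔Gₓ {x} {u} zero⇒∈ with proj₁ x ≟ t₀
    ... | yes x≡t₀ = mk⇔
      (λ ((_ , x≢x¹) , x≢u) → (λ e≡1 → x≢x¹ (≡x¹ x≡t₀ e≡1)) , x≢u)
      (λ (x≢1 , x≢u) → ((λ e≡0 → t₀∉ts (subst (_∈ ts) x≡t₀ (zero⇒∈ e≡0))) ,
                        λ x≡x¹ → x≢1 (trans (cong exponent x≡x¹) (exponent-x¹ t₀))) , x≢u)
    ... | no x≢t₀ = mk⇔
      (λ ((x≢0 , _) , x≢u) → x≢0 , x≢u)
      (λ (x≢0 , x≢u) → (x≢0 , x≢t₀ ∘ cong proj₁) , x≢u)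

    Fs′ : List (Vec Bool (length (t₀ ∷ ts) + suc n))
    Fs′ = stackAt Fs (index F∈)

    cone-represents : ∀ {v} → T (lookup F v) →
                      Represents (t₀ ∷ ts) (true ∷ (F [ v ]≔ false)) (InG (δ t₀) (vertex ts v))
    cone-represents {v} Fv = represents-∷ F∖v-represents (mk⇔ (λ _ → new-vertex-included) (λ _ → tt))
      where
        new-vertex-included : InG (δ t₀) (vertex ts v) (t₀ , zero)
        new-vertex-included = (λ 0≡δ → 0≢1+n (trans 0≡δ (δ-≡ t₀))) ,
                              λ t₀⁰≡v → proj₁ (to (lookup⇔ F-represents v) Fv) (cong exponent (sym t₀⁰≡v))
        F∖v-represents : Represents ts (F [ v ]≔ false) (InG (δ t₀) (vertex ts v))
        lookup⇔ F∖v-represents w = mk⇔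
          (λ F∖v-w → let (Fw , w≢v) = to (T-lookup-[]≔false F v w) F∖v-w in
                     to (pivot∖u⇔Gₓ (vertex-exponent≡0 ts w))
                        (to (lookup⇔ F-represents w) Fw , w≢v ∘ vertex-injective ts-unique))
          (λ inG → let (in-pivot , x≢u) = from (pivot∖u⇔Gₓ (vertex-exponent≡0 ts w)) inG in
                   from (T-lookup-[]≔false F v w) (from (lookup⇔ F-represents w) in-pivot , x≢u ∘ cong (vertex ts)))

    kept-facet : ∀ {S} (d : Facet ts) → Represents ts S ⟦ d ⟧ → S ≢ F →
                 Σ (Facet (t₀ ∷ ts)) λ d′ → Represents (t₀ ∷ ts) (false ∷ S) ⟦ d′ ⟧
    kept-facet (G₁ u u>0 u∉) S-rep S≢F = G₁ u u>0 u∉′ , represents-∷ S-rep (new-vertex-excluded (λ _ → 0) refl)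
      where
        u∉′ : exponent u ≡ 1 → proj₁ u ∉ t₀ ∷ ts
        u∉′ e≡1 (here u≡t₀) = S≢F (represents-injective S-rep
          (subst (Represents ts F ∘ InG (λ _ → 0)) (sym (≡x¹ u≡t₀ e≡1)) F-represents))
        u∉′ e≡1 (there u∈) = u∉ e≡1 u∈
    kept-facet (Gₓ t t∈ u p) S-rep _ =
      Gₓ t (there t∈) u p , represents-∷ S-rep (new-vertex-excluded (δ t) (sym (δ-≢ (t₀≢ t∈))))

    sound′ : ∀ {S′} → S′ ∈ Fs′ → Σ (Facet (t₀ ∷ ts)) λ d → Represents (t₀ ∷ ts) S′ ⟦ d ⟧
    sound′ S′∈ with ∈-stackAt⁻ F∈ unique S′∈
    ... | inj₁ (S , S∈ , S≢F , refl) = let (d , S-rep) = sound S∈ in kept-facet d S-rep S≢F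
    ... | inj₂ (v , Fv , refl) =
      Gₓ t₀ (here refl) (vertex ts v) (to pivot⇔cone (to (lookup⇔ F-represents v) Fv)) , cone-represents Fv

    complete′ : (d : Facet (t₀ ∷ ts)) → ∃[ S′ ] (S′ ∈ Fs′ × Represents (t₀ ∷ ts) S′ ⟦ d ⟧)
    complete′ (G₁ u u>0 u∉) with complete (G₁ u u>0 (λ e≡1 → u∉ e≡1 ∘ there))
    ... | S , S∈ , S-rep =
      false ∷ S , ∈-stackAt⁺ˡ F∈ S∈ S≢F , represents-∷ S-rep (new-vertex-excluded (λ _ → 0) refl)
      where
        S≢F : S ≢ F
        S≢F = represents-≢ S-rep F-represents (x¹-reached t₀)
          ((λ ()) , λ x¹≡u → u∉ (trans (cong exponent (sym x¹≡u)) (exponent-x¹ t₀))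
                                (here (cong proj₁ (sym x¹≡u))))
          (λ (_ , x¹≢x¹) → x¹≢x¹ refl)
    complete′ (Gₓ t (here refl) u p) with vertex-surjective ts u (inj₁ (≤-<-trans z≤n p))
    ... | v , refl = true ∷ (F [ v ]≔ false) , ∈-stackAt⁺ʳ F∈ Fv , cone-represents Fv
      where
        Fv : T (lookup F v)
        Fv = from (lookup⇔ F-represents v) (from pivot⇔cone p)
    complete′ (Gₓ t (there t∈) u p) with complete (Gₓ t t∈ u p)
    ... | S , S∈ , S-rep =
      false ∷ S , ∈-stackAt⁺ˡ F∈ S∈ S≢F , represents-∷ S-rep (new-vertex-excluded (δ t) (sym (δ-≢ (t₀≢ t∈))))
      where
        S≢F : S ≢ F
        S≢F = ≢-sym (represents-≢ F-represents S-rep (x¹-reached t)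
          ((λ ()) , λ x¹≡x¹ → t₀≢ t∈ (sym (cong proj₁ x¹≡x¹)))
          (λ (x¹≢δ , _) → x¹≢δ (trans (exponent-x¹ t) (sym (δ-≡ t)))))

    stacked-lists : ListsBierFacets (t₀ ∷ ts) Fs′
    stacked-lists = record { unique = stackAt-unique F∈ unique ; sound = sound′ ; complete = complete′ }

  stackedBierFacets : ∀ ts → Unique ts →
                      Σ (List (Vec Bool (length ts + suc n))) λ Fs → Stacked n (length ts) Fs × ListsBierFacets ts Fs
  stackedBierFacets [] _ = simplexBoundary n , base , simplexBoundary-lists
  stackedBierFacets (t ∷ ts) t∷ts-unique@(_ ∷ ts-unique) =
    let (Fs , Fs-stacked , Fs-lists) = stackedBierFacets ts ts-unique
        open Stacking (Unique[x∷xs]⇒x∉xs t∷ts-unique) ts-unique Fs-lists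
    in Fs′ , step Fs-stacked (index F∈) , stacked-lists

  module _ {M : Mono c → Set} {ts} (M⇔ : ∀ a → M a ⇔ GeneratedBy ts a) (1∈M : M (λ _ → zero)) where

    Gset⇒facet : ∀ {a} i j → M a → toℕ (a i) < toℕ j → ¬ M (a ⋄ i ↦ j) →
                 Σ (Facet ts) λ d → ∀ v → T (Gset a i j v) ⇔ ⟦ d ⟧ v
    Gset⇒facet {a} i j Ma aᵢ<j a⋄∉M with to (M⇔ a) Ma
    ... | t , t∈ , a∣x with ∣x⇒1⊎x a∣x
    ... | inj₁ a≡1 = G₁ (i , j) (subst (_< toℕ j) (a≡1 i) aᵢ<j) i∉ , λ v → T-Gset a i j v a≡1
      where
        i∉ : toℕ j ≡ 1 → i ∉ ts
        i∉ j≡1 i∈ = a⋄∉M (from (M⇔ _) (i , i∈ , ⋄∣x))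
          where
            ⋄∣x : (a ⋄ i ↦ j) ∣x i
            ⋄∣x i′ with i′ ≟ i
            ... | yes refl = ≤-reflexive j≡1
            ... | no _ = ≤-reflexive (a≡1 i′)
    ... | inj₂ a≡x = Gₓ t t∈ (i , j) (subst (_< toℕ j) (a≡x i) aᵢ<j) , λ v → T-Gset a i j v a≡x

    bierFacet⇒facet : ∀ {G} → BierFacet c M G → Σ (Facet ts) λ d → ∀ v → T (G v) ⇔ ⟦ d ⟧ v
    bierFacet⇒facet (a , Ma , i , j , aᵢ<j , a⋄∉M , G≗) =
      let (d , Gset⇔) = Gset⇒facet i j Ma aᵢ<j a⋄∉M in
      d , λ v → subst (λ b → T b ⇔ ⟦ d ⟧ v) (sym (G≗ v)) (Gset⇔ v)

    facet⇒bierFacet : (d : Facet ts) → Σ (Vtx c → Bool) λ G → BierFacet c M G × (∀ v → T (G v) ⇔ ⟦ d ⟧ v)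
    facet⇒bierFacet (G₁ (i , j) j>0 i∉) =
      Gset 1ᵐ i j , (1ᵐ , 1∈M , i , j , j>0 , 1⋄j∉M , λ _ → refl) , λ v → T-Gset 1ᵐ i j v (λ _ → refl)
      where
        1ᵐ : Mono c
        1ᵐ _ = zero
        1⋄j∉M : ¬ M (1ᵐ ⋄ i ↦ j)
        1⋄j∉M 1⋄j∈M =
          let (t , t∈ , ⋄∣x) = to (M⇔ _) 1⋄j∈M
              j≤1 = subst (λ j′ → toℕ j′ ≤ 1) (⋄-≡ 1ᵐ i j) (∣x-≤1 i ⋄∣x)
              i≡t = ∣x-support ⋄∣x (subst (λ j′ → 0 < toℕ j′) (sym (⋄-≡ 1ᵐ i j)) j>0)
          in i∉ (≤-antisym j≤1 j>0) (subst (_∈ ts) (sym i≡t) t∈)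
    facet⇒bierFacet (Gₓ t t∈ (i , j) δ<j) =
      Gset (xMono t) i j ,
      (xMono t , from (M⇔ _) (t , t∈ , ≤-reflexive ∘ toℕ-xMono t) , i , j ,
       subst (_< toℕ j) (sym (toℕ-xMono t i)) δ<j , x⋄j∉M , λ _ → refl) ,
      λ v → T-Gset (xMono t) i j v (toℕ-xMono t)
      where
        x⋄j∉M : ¬ M (xMono t ⋄ i ↦ j)
        x⋄j∉M x⋄j∈M with to (M⇔ _) x⋄j∈M | i ≟ t
        ... | _ , _ , ⋄∣x | yes refl =
          <⇒≱ (subst (_< toℕ j) (δ-≡ t) δ<j)
              (subst (λ j′ → toℕ j′ ≤ 1) (⋄-≡ (xMono t) t j) (∣x-≤1 t ⋄∣x))
        ... | _ , _ , ⋄∣x | no i≢t = i≢t (trans (∣x-support ⋄∣x j>0) (sym (∣x-support ⋄∣x xₜ>0)))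
          where
            j>0 : 0 < toℕ ((xMono t ⋄ i ↦ j) i)
            j>0 = subst (λ j′ → 0 < toℕ j′) (sym (⋄-≡ (xMono t) i j)) (≤-<-trans z≤n δ<j)
            xₜ>0 : 0 < toℕ ((xMono t ⋄ i ↦ j) t)
            xₜ>0 = subst (λ x → 0 < toℕ x) (sym (⋄-≢ (xMono t) j (≢-sym i≢t)))
                         (subst (0 <_) (sym (trans (toℕ-xMono t t) (δ-≡ t))) (s≤s z≤n))

    reached : ∀ {G} → BierFacet c M G → ∀ v → G v ≡ true → ∃[ w ] vertex ts w ≡ v
    reached (a , Ma , i , j , _ , _ , G≗) v Gv = vertex-surjective ts v positive⊎∈
      where
        v≢own : exponent v ≢ toℕ (a (proj₁ v))
        v≢own = proj₁ (to (T-Gset a i j v (λ _ → refl)) (subst T (G≗ v) (from T-≡ Gv)))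
        positive⊎∈ : 0 < exponent v ⊎ proj₁ v ∈ ts
        positive⊎∈ with exponent v ℕ.≟ 0 | to (M⇔ a) Ma
        ... | no v≢0 | _ = inj₁ (n≢0⇒n>0 v≢0)
        ... | yes v≡0 | t , t∈ , a∣x =
          inj₂ (subst (_∈ ts) (sym (∣x-support a∣x (n≢0⇒n>0 (λ a≡0 → v≢own (trans v≡0 (sym a≡0)))))) t∈)

    generated⇒bierStackedVC : Unique ts → BierStackedVC c M n (length ts)
    generated⇒bierStackedVC ts-unique =
      let (Fs , Fs-stacked , Fs-lists) = stackedBierFacets ts ts-unique
          open ListsBierFacets Fs-lists
      in Fs , Fs-stacked , vertex ts , vertex-injective ts-unique , (λ _ → reached) ,
         (λ G G-facet → let (d , G⇔d) = bierFacet⇒facet G-facet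
                            (S , S∈ , S-rep) = complete d
                        in S , S∈ , represents-agree G⇔d S-rep) ,
         (λ S S∈ → let (d , S-rep) = sound S∈
                       (G , G-facet , G⇔d) = facet⇒bierFacet d
                   in G , G-facet , represents-agree G⇔d S-rep)

module _ {m k : ℕ} (k≤m : k ≤ m) where

  firstVars : List (Fin m)
  firstVars = L.tabulate (λ t → inject≤ t k≤m)

  length-firstVars : length firstVars ≡ k
  length-firstVars = length-tabulate _

  firstVars-unique : Unique firstVars
  firstVars-unique = tabulate⁺ (inject≤-injective k≤m k≤m _ _)

  ∈-firstVars : ∀ {t} → t ∈ firstVars ⇔ toℕ t < k
  ∈-firstVars {t} = mk⇔
    (λ t∈ → let (t′ , t≡t′) = ∈-tabulate⁻ t∈ in
            subst (_< k) (sym (trans (cong toℕ t≡t′) (toℕ-inject≤ t′ k≤m))) (toℕ<n t′))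
    (λ t<k → subst (_∈ firstVars)
               (toℕ-injective (trans (toℕ-inject≤ (fromℕ< t<k) k≤m) (toℕ-fromℕ< t<k)))
               (∈-tabulate⁺ (fromℕ< t<k)))

  generatedByFirstVars : ∀ {c : Fin m → ℕ} {M} → IsGenByFirstVars c k M → ∀ a → M a ⇔ GeneratedBy firstVars a
  generatedByFirstVars gen a = ⇔-trans (gen a)
    (mk⇔ (λ (t , t<k , a∣x) → t , from ∈-firstVars t<k , a∣x)
         (λ (t , t∈ , a∣x) → t , to ∈-firstVars t∈ , a∣x))

mainTheorem10 : (m : ℕ) → 2 ≤ m → (c : Fin m → ℕ) → ((i : Fin m) → 1 ≤ c i) →
    (M : Mono c → Set) → IsMulticomplex c M → Proper c M →
    ((k : ℕ) → 1 ≤ k → k ≤ m → IsGenByFirstVars c k M →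
       BierStackedVC c M (∣ c ∣c ∸ 1) k)
    × ((k : ℕ) → BierStackedVC c M (∣ c ∣c ∸ 1) k → k ≤ m)
mainTheorem10 (suc m) _ c c≥1 M M-multicomplex _ =
  (λ k _ k≤m gen → subst (BierStackedVC c M n) (length-firstVars k≤m)
     (generated⇒bierStackedVC (generatedByFirstVars k≤m gen) 1∈M (firstVars-unique k≤m))) ,
  (λ _ → bierStackedVC⇒≤ n+1≡∣c∣)
  where
    n : ℕ
    n = ∣ c ∣c ∸ 1

    n+1≡∣c∣ : suc n ≡ ∣ c ∣c
    n+1≡∣c∣ = m+[n∸m]≡n (≤-trans (c≥1 zero) (m≤m+n (c zero) _))

    open Construction c c≥1 n n+1≡∣c∣
    open IsMulticomplex M-multicomplex

    1∈M : M (λ _ → zero)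
    1∈M = let (a , Ma) = nonempty in divClosed a _ Ma (λ _ → z≤n)
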